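{- Let $g$ be a positive integer and $K$ a set of positive integers. If there exists a PBD$(v,K)$ such that for every $k\in K$ there exists a Kirkman frame of type $(g;2g)^k$, then there exists a Kirkman frame of type $(g;2g)^v$.
   Context: A PBD$(v,K)$ is a set of $v$ points with a collection of blocks whose sizes lie in $K$ such that every pair of distinct points lies in exactly one block. A 3-GDD of type $g^u$ on a point set $V$ is a partition of $V$ into $u$ groups of size $g$ together with a set of 3-subsets (blocks) each meeting every group in at most one point, such that any two points in different groups lie in exactly one block. A Kirkman frame is a 3-GDD whose blocks can be partitioned into partial parallel classes, each of which is a partition of $V\setminus V_i$ for some group $V_i$. A Kirkman frame of type $(g;h)^u$ is a Kirkman frame of type $h^u$ (groups $V_1,\dots,V_u$, block set $\mathcal{B}$) together with a 3-GDD of type $g^u$ with groups $W_1,\dots,W_u$ and block set $\mathcal{A}$ such that $W_i\subseteq V_i$ for all $i$ and $\mathcal{A}\subseteq\mathcal{B}$. -}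

module Defs where

open import Data.Nat using (ℕ)
open import Data.Fin using (Fin)
open import Data.Bool using (Bool; T)
open import Data.List using (List; length)
open import Data.List.Membership.Propositional using (_∈_)
open import Data.List.Relation.Unary.Unique.Propositional using (Unique)
open import Data.Product using (Σ; _×_; ∃; proj₁; _,_)
open import Function.Bundles using (_↔_; _⇔_)
open import Relation.Binary.PropositionalEquality using (_≡_; _≢_)
open import Level using (Level)

ExactlyOne : {n : ℕ} → (Fin n → Set) → Set
ExactlyOne {n} P = Σ (Fin n) λ i → P i × (∀ j → P j → j ≡ i)

record PBD (v : ℕ) (K : ℕ → Set) : Set where
  field
    nblocks    : ℕ
    block      : Fin nblocks → List (Fin v)
    blockDistinct : ∀ b → Unique (block b)
    blockSize  : ∀ b → K (length (block b))
    pairCover  : ∀ (x y : Fin v) → x ≢ y →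
                 ExactlyOne (λ b → (x ∈ block b) × (y ∈ block b))

-- A block is a triple of points (Fin 3 → X), meeting every group in at
-- most one point (hence its three points are distinct); blocks are
-- considered as the sets of their points.

_∈B_ : {X : Set} → X → (Fin 3 → X) → Set
x ∈B t = ∃ λ j → t j ≡ x

record GDD3 (X : Set) (g u : ℕ) : Set where
  field
    group      : X → Fin u
    groupSize  : ∀ (i : Fin u) → (Σ X λ x → group x ≡ i) ↔ Fin g
    nblocks    : ℕ
    block      : Fin nblocks → Fin 3 → X
    transversal : ∀ b (j k : Fin 3) → j ≢ k → group (block b j) ≢ group (block b k)
    pairCover  : ∀ (x y : X) → group x ≢ group y →
                 ExactlyOne (λ b → (x ∈B block b) × (y ∈B block b))

-- Kirkman frame of type h^u: a 3-GDD of type h^u whose blocks are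
-- partitioned (via `cls`) into partial parallel classes; class c is a
-- partition of V ∖ V_(hole c).
record KirkmanFrame (X : Set) (h u : ℕ) : Set where
  field
    gdd      : GDD3 X h u
  open GDD3 gdd
  field
    nclasses : ℕ
    cls      : Fin nblocks → Fin nclasses
    hole     : Fin nclasses → Fin u
    avoidsHole : ∀ b (j : Fin 3) → group (block b j) ≢ hole (cls b)
    classPartition : ∀ (c : Fin nclasses) (x : X) → group x ≢ hole c →
                     ExactlyOne (λ b → (cls b ≡ c) × (x ∈B block b))

-- Kirkman frame of type (g;h)^u on point set X: a Kirkman frame of type
-- h^u (groups V_i, blocks ℬ) together with a 3-GDD of type g^u on the
-- subset W = {x | inW x} with groups W_i ⊆ V_i and blocks 𝒜 ⊆ ℬ.
record KirkmanFrameGH (X : Set) (g h u : ℕ) : Set where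
  field
    frame : KirkmanFrame X h u
    inW   : X → Bool
    sub   : GDD3 (Σ X λ x → T (inW x)) g u
  module B = GDD3 (KirkmanFrame.gdd frame)
  module A = GDD3 sub
  field
    groupsNested : ∀ (w : Σ X λ x → T (inW x)) → A.group w ≡ B.group (proj₁ w)
    blocksSub    : ∀ (a : Fin A.nblocks) → Σ (Fin B.nblocks) λ b →
                     ∀ (x : X) → (Σ (T (inW x)) λ p → (x , p) ∈B A.block a) ⇔ (x ∈B B.block b)

KFExists : (g h u : ℕ) → Set₁
KFExists g h u = Σ Set λ X → KirkmanFrameGH X g h u

-- A Kirkman frame of type (g;2g)^k, k ≥ 2, is first brought into a normal form.  Each
-- group has g points in W and g outside, so points can be relabelled (group, in W?, index).
-- The blocks through a point y pair off the 2g(k-1) points outside its group, and each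
-- partial parallel class avoiding that group contains exactly one of them; hence y lies in
-- g(k-1) blocks, as many classes avoid each group, and comparing with the total number of
-- classes leaves exactly g classes at every hole, which can be numbered by Fin g.  The
-- sub-3-GDD is determined by the frame: its blocks are the blocks inside W, because a block
-- with two points in W must be the block of the sub-GDD through them.
--
-- Normal forms are glued along the PBD (Wilson's fundamental construction): the blocks are
-- those of the frames on the PBD blocks, and the t-th class at hole i is the union of the
-- t-th classes at hole i over the PBD blocks through i.  Two points in different groups lie
-- in a unique PBD block, which gives pair covering and the partition property.

module Submission where

open import Defs
open import Data.Nat using (ℕ; zero; suc; _+_; _*_; _≤_; _≤?_; z≤n; s≤s)
import Data.Nat.Properties as ℕ
open import Data.Bool using (Bool; true; false; T)
open import Data.Bool.Properties using (T-irrelevant; T-≡; T-not-≡) renaming (_≟_ to _≟ᵇ_)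
open import Data.Empty using (⊥-elim)
open import Data.Fin using (Fin; zero; suc; _≟_; punchIn; punchOut; fromℕ<)
open import Data.Fin.Properties
  using (+↔⊎; *↔×; 2↔Bool; all?; punchInᵢ≢i; punchIn-punchOut; punchOut-cong; punchOut-punchIn)
open import Data.Fin.Permutation using (↔⇒≡)
open import Data.Product using (Σ; _×_; _,_; proj₁; proj₂; ∃)
open import Data.Product.Function.NonDependent.Propositional using (_×-↔_)
open import Data.Sum using (_⊎_; inj₁; inj₂)
open import Data.Sum.Function.Propositional using (_⊎-↔_)
open import Data.Unit using (tt)
open import Data.Vec.Functional using (foldr)
open import Data.List using (List; length; lookup)
open import Data.List.Membership.Propositional using (_∈_)
open import Data.List.Membership.Propositional.Properties using (∈-lookup)
import Data.List.Relation.Unary.All as All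
open import Data.List.Relation.Unary.AllPairs using (_∷_)
open import Data.List.Relation.Unary.Any using (index)
open import Data.List.Relation.Unary.Any.Properties using (lookup-index)
open import Data.List.Relation.Unary.Unique.Propositional using (Unique)
open import Function using (_∘_)
open import Function.Bundles using (_↔_; Inverse; mk↔ₛ′; Equivalence; mk⇔; _⇔_)
open import Function.Properties.Inverse using (↔-refl; ↔-sym; ↔-trans)
open import Relation.Binary.Definitions using (DecidableEquality)
open import Relation.Binary.PropositionalEquality
open import Relation.Binary.PropositionalEquality.WithK using (≡-irrelevant)
open import Relation.Nullary using (¬_; yes; no)
open import Relation.Nullary.Decidable
  using (Dec; ⌊_⌋; T?; toWitness; fromWitness; toWitnessFalse; fromWitnessFalse)

open Inverse using (to; from; strictlyInverseˡ; strictlyInverseʳ; inverseˡ; inverseʳ)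
module ⇔ = Equivalence

private variable
  A B : Set
  m m′ n : ℕ

-- Finite types and fibres

Fibre : (A → B) → B → Set
Fibre {A} f b = Σ A λ a → f a ≡ b

fibres-↔ : (f : A → B) → A ↔ Σ B (Fibre f)
fibres-↔ f = mk↔ₛ′ (λ a → f a , a , refl) (λ (_ , a , _) → a)
  (λ { (_ , a , refl) → refl }) (λ _ → refl)

Σ-map-↔ : {P Q : A → Set} → (∀ a → P a ↔ Q a) → Σ A P ↔ Σ A Q
Σ-map-↔ e = mk↔ₛ′ (λ (a , p) → a , to (e a) p) (λ (a , q) → a , from (e a) q)
  (λ (a , q) → cong (a ,_) (strictlyInverseˡ (e a) q))
  (λ (a , p) → cong (a ,_) (strictlyInverseʳ (e a) p))

Σ-Bool-↔ : {P : Bool → Set} → Σ Bool P ↔ (P true ⊎ P false)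
Σ-Bool-↔ = mk↔ₛ′
  (λ { (true , p) → inj₁ p ; (false , p) → inj₂ p })
  (λ { (inj₁ p) → true , p ; (inj₂ p) → false , p })
  (λ { (inj₁ p) → refl ; (inj₂ p) → refl })
  (λ { (true , p) → refl ; (false , p) → refl })

Σ-Fin-suc-↔ : {P : Fin (suc n) → Set} → Σ (Fin (suc n)) P ↔ (P zero ⊎ Σ (Fin n) (P ∘ suc))
Σ-Fin-suc-↔ = mk↔ₛ′
  (λ { (zero , p) → inj₁ p ; (suc i , p) → inj₂ (i , p) })
  (λ { (inj₁ p) → zero , p ; (inj₂ (i , p)) → suc i , p })
  (λ { (inj₁ p) → refl ; (inj₂ (i , p)) → refl })
  (λ { (zero , p) → refl ; (suc i , p) → refl })

Fin-⊎-↔ : A ↔ Fin m → B ↔ Fin n → (A ⊎ B) ↔ Fin (m + n)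
Fin-⊎-↔ e f = ↔-trans (e ⊎-↔ f) (↔-sym +↔⊎)

Fin-×-↔ : A ↔ Fin m → B ↔ Fin n → (A × B) ↔ Fin (m * n)
Fin-×-↔ e f = ↔-trans (e ×-↔ f) (↔-sym *↔×)

Σ-Fin-↔ : (f : Fin n → ℕ) → Σ (Fin n) (Fin ∘ f) ↔ Fin (foldr _+_ 0 f)
Σ-Fin-↔ {zero}  f = mk↔ₛ′ (λ ()) (λ ()) (λ ()) (λ ())
Σ-Fin-↔ {suc n} f = ↔-trans Σ-Fin-suc-↔ (Fin-⊎-↔ ↔-refl (Σ-Fin-↔ (f ∘ suc)))

Σ-const-↔ : ∀ {c} {P : Fin n → Set} → (∀ i → P i ↔ Fin c) → Σ (Fin n) P ↔ Fin (n * c)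
Σ-const-↔ e = ↔-trans (Σ-map-↔ e) (↔-sym *↔×)

size-unique : A ↔ Fin m → A ↔ Fin n → m ≡ n
size-unique e f = ↔⇒≡ (↔-trans (↔-sym e) f)

Finite : Set → Set
Finite A = ∃ λ n → A ↔ Fin n

≡-finite : DecidableEquality A → (a b : A) → Finite (a ≡ b)
≡-finite _≟ᴬ_ a b with a ≟ᴬ b
... | yes refl = 1 , mk↔ₛ′ (λ _ → zero) (λ _ → refl) (λ { zero → refl }) (≡-irrelevant _)
... | no a≢b   = 0 , mk↔ₛ′ (⊥-elim ∘ a≢b) (λ ()) (λ ()) (⊥-elim ∘ a≢b)

fibre-finite-Fin : DecidableEquality B → (f : Fin n → B) (b : B) → Finite (Fibre f b)
fibre-finite-Fin {n = zero}  _≟ᴮ_ f b = 0 , mk↔ₛ′ (λ ()) (λ ()) (λ ()) (λ ())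
fibre-finite-Fin {n = suc n} _≟ᴮ_ f b
  with ≡-finite _≟ᴮ_ (f zero) b | fibre-finite-Fin _≟ᴮ_ (f ∘ suc) b
... | m₀ , e₀ | m , e = m₀ + m , ↔-trans Σ-Fin-suc-↔ (Fin-⊎-↔ e₀ e)

Fibre-≡ : {f : A → B} {b : B} {x y : Fibre f b} → proj₁ x ≡ proj₁ y → x ≡ y
Fibre-≡ {x = a , p} {.a , q} refl = cong (a ,_) (≡-irrelevant p q)

Fibre-↔ : {A′ : Set} (e : A ↔ A′) (f : A → B) (b : B) → Fibre f b ↔ Fibre (f ∘ from e) b
Fibre-↔ e f b = mk↔ₛ′
  (λ (a , fa≡b) → to e a , trans (cong f (strictlyInverseʳ e a)) fa≡b)
  (λ (a′ , fa′≡b) → from e a′ , fa′≡b)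
  (λ (a′ , _) → Fibre-≡ (strictlyInverseˡ e a′))
  (λ (a , _) → Fibre-≡ (strictlyInverseʳ e a))

fibre-finite : DecidableEquality B → A ↔ Fin n → (f : A → B) (b : B) → Finite (Fibre f b)
fibre-finite _≟ᴮ_ e f b with fibre-finite-Fin _≟ᴮ_ (f ∘ from e) b
... | m , e′ = m , ↔-trans (Fibre-↔ e f b) e′

fibres-uniform-↔ : {F : Set} (f : A → B) → (∀ b → Fibre f b ↔ F) → A ↔ (B × F)
fibres-uniform-↔ f e = ↔-trans (fibres-↔ f) (Σ-map-↔ e)

proj₁-fibre-↔ : {F : Set} (b : B) → Fibre (proj₁ {B = λ (_ : B) → F}) b ↔ F
proj₁-fibre-↔ b = mk↔ₛ′ (λ ((_ , x) , _) → x) (λ x → (b , x) , refl)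
  (λ _ → refl) (λ { ((_ , x) , refl) → refl })

Bool-fibres-size : A ↔ Fin n → (p : A → Bool) →
                   Fibre p true ↔ Fin m → Fibre p false ↔ Fin m′ → m + m′ ≡ n
Bool-fibres-size e p e₁ e₂ =
  size-unique (↔-trans (fibres-↔ p) (↔-trans Σ-Bool-↔ (Fin-⊎-↔ e₁ e₂))) e

ExactlyOne-map : {P Q : Fin n → Set} → (∀ i → P i → Q i) → (∀ i → Q i → P i) →
                 ExactlyOne P → ExactlyOne Q
ExactlyOne-map P⇒Q Q⇒P (i , p , unique) = i , P⇒Q i p , λ j q → unique j (Q⇒P j q)

ExactlyOne-via : (e : A ↔ Fin n) {Q : A → Set} (a : A) → Q a →
                 (∀ a′ → Q a′ → a′ ≡ a) → ExactlyOne (Q ∘ from e)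
ExactlyOne-via e {Q} a q unique =
  to e a , subst Q (sym (strictlyInverseʳ e a)) q ,
  λ i qi → trans (sym (strictlyInverseˡ e i)) (cong (to e) (unique _ qi))

ExactlyOne-Σ : {I : Set} {size : I → ℕ} (e : Σ I (Fin ∘ size) ↔ Fin n)
               {Q : Σ I (Fin ∘ size) → Set}
               (i : I) → (∀ σ → Q σ → proj₁ σ ≡ i) → ExactlyOne (λ b → Q (i , b)) →
               ExactlyOne (Q ∘ from e)
ExactlyOne-Σ e {Q} i in-i (b , q , unique) =
  ExactlyOne-via e (i , b) q λ σ qσ → lemma σ (in-i σ qσ) qσ
  where
  lemma : ∀ σ → proj₁ σ ≡ i → Q σ → σ ≡ (i , b)
  lemma (.i , b′) refl qσ = cong (i ,_) (unique b′ qσ)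

module _ {P : Set} (P? : Dec P) where

  ⌊⌋≡true⇔ : (⌊ P? ⌋ ≡ true) ⇔ P
  ⌊⌋≡true⇔ = mk⇔ (toWitness ∘ ⇔.from T-≡) (⇔.to T-≡ ∘ fromWitness)

  ⌊⌋≡false⇔ : (⌊ P? ⌋ ≡ false) ⇔ (¬ P)
  ⌊⌋≡false⇔ = mk⇔ (toWitnessFalse ∘ ⇔.from T-not-≡) (⇔.to T-not-≡ ∘ fromWitnessFalse)

⌊≟⌋-fibre-↔ : (_≟ᴮ_ : DecidableEquality B) (f : A → B) (b : B) →
              Fibre (λ a → ⌊ f a ≟ᴮ b ⌋) true ↔ Fibre f b
⌊≟⌋-fibre-↔ _≟ᴮ_ f b = mk↔ₛ′
  (λ (a , eq) → a , ⇔.to (⌊⌋≡true⇔ (f a ≟ᴮ b)) eq)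
  (λ (a , eq) → a , ⇔.from (⌊⌋≡true⇔ (f a ≟ᴮ b)) eq)
  (λ _ → Fibre-≡ refl) (λ _ → Fibre-≡ refl)

-- Kirkman frames of type (g;2g)^k in normal form

-- (i , w , t) is the t-th point of group i inside W (w = true) or outside it.
Point : ℕ → ℕ → Set
Point g k = Fin k × Bool × Fin g

isW : ∀ {g k} → Point g k → Bool
isW (_ , w , _) = w

-- The partial parallel classes are indexed by their hole and a number in Fin g; the
-- sub-3-GDD on W is not recorded: by W-closed, the blocks inside W form one.
record CanonicalFrame (g k : ℕ) : Set where
  field
    nblocks        : ℕ
    block          : Fin nblocks → Fin 3 → Point g k
    transversal    : ∀ b (j l : Fin 3) → j ≢ l → proj₁ (block b j) ≢ proj₁ (block b l)
    pairCover      : ∀ (x y : Point g k) → proj₁ x ≢ proj₁ y →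
                     ExactlyOne (λ b → (x ∈B block b) × (y ∈B block b))
    W-closed       : ∀ b (j l : Fin 3) → j ≢ l → T (isW (block b j)) → T (isW (block b l)) →
                     ∀ m → T (isW (block b m))
    hole           : Fin nblocks → Fin k
    class          : Fin nblocks → Fin g
    avoidsHole     : ∀ b (j : Fin 3) → proj₁ (block b j) ≢ hole b
    classPartition : ∀ (i : Fin k) (t : Fin g) (y : Point g k) → proj₁ y ≢ i →
                     ExactlyOne (λ b → (hole b ≡ i) × (class b ≡ t) × (y ∈B block b))

module FromCanonical {g v : ℕ} (C : CanonicalFrame g v) where
  open CanonicalFrame C

  group-↔ : ∀ i → Fibre {A = Point g v} proj₁ i ↔ Fin (2 * g)
  group-↔ i =
    ↔-trans (proj₁-fibre-↔ {F = Bool × Fin g} i) (Fin-×-↔ {m = 2} {n = g} (↔-sym 2↔Bool) ↔-refl)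

  gdd : GDD3 (Point g v) (2 * g) v
  gdd = record
    { group = proj₁ ; groupSize = group-↔ ; nblocks = nblocks ; block = block
    ; transversal = transversal ; pairCover = pairCover }

  classes-↔ : Fin (v * g) ↔ (Fin v × Fin g)
  classes-↔ = *↔×

  frame : KirkmanFrame (Point g v) (2 * g) v
  frame = record
    { gdd = gdd
    ; nclasses = v * g
    ; cls = λ b → from classes-↔ (hole b , class b)
    ; hole = λ c → proj₁ (to classes-↔ c)
    ; avoidsHole = λ b j eq → avoidsHole b j (trans eq (cong proj₁ (strictlyInverseˡ classes-↔ _)))
    ; classPartition = λ c y y∉hole →
        let (i , t) = to classes-↔ c in
        ExactlyOne-map
          (λ b (hb≡i , cb≡t , y∈b) → inverseʳ classes-↔ (cong₂ _,_ hb≡i cb≡t) , y∈b)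
          (λ b (clsb≡c , y∈b) → let eq = sym (inverseˡ classes-↔ (sym clsb≡c)) in
                                 cong proj₁ eq , cong proj₂ eq , y∈b)
          (classPartition i t y y∉hole) }

  WPoint : Set
  WPoint = Σ (Point g v) (T ∘ isW)

  W-group-↔ : ∀ i → Fibre {A = WPoint} (proj₁ ∘ proj₁) i ↔ Fin g
  W-group-↔ i = mk↔ₛ′ (λ (((_ , _ , t) , _) , _) → t) (λ t → ((i , true , t) , tt) , refl)
    (λ _ → refl) (λ { (((_ , true , t) , tt) , refl) → refl })

  inW-block : Fin nblocks → Bool
  inW-block b = ⌊ all? (λ j → T? (isW (block b j))) ⌋

  inW-block-sound : ∀ {b} → inW-block b ≡ true → ∀ j → T (isW (block b j))
  inW-block-sound = ⇔.to (⌊⌋≡true⇔ _)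

  inW-block-complete : ∀ {b} → (∀ j → T (isW (block b j))) → inW-block b ≡ true
  inW-block-complete = ⇔.from (⌊⌋≡true⇔ _)

  nWblocks : ℕ
  nWblocks = proj₁ (fibre-finite _≟ᵇ_ ↔-refl inW-block true)

  Wblocks-↔ : Fibre inW-block true ↔ Fin nWblocks
  Wblocks-↔ = proj₂ (fibre-finite _≟ᵇ_ ↔-refl inW-block true)

  Wblock-points : Fibre inW-block true → Fin 3 → WPoint
  Wblock-points (b , b∈W) j = block b j , inW-block-sound b∈W j

  WPoint-≡ : {x y : WPoint} → proj₁ x ≡ proj₁ y → x ≡ y
  WPoint-≡ {x , p} {.x , q} refl = cong (x ,_) (T-irrelevant p q)

  ∈Wblock⇔ : ∀ (x : WPoint) σ → (x ∈B Wblock-points σ) ⇔ (proj₁ x ∈B block (proj₁ σ))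
  ∈Wblock⇔ x σ = mk⇔ (λ (j , eq) → j , cong proj₁ eq) (λ (j , eq) → j , WPoint-≡ eq)

  Wblock : Fin nWblocks → Fin 3 → WPoint
  Wblock = Wblock-points ∘ from Wblocks-↔

  W-pairCover : ∀ (x y : WPoint) → proj₁ (proj₁ x) ≢ proj₁ (proj₁ y) →
                ExactlyOne (λ a → (x ∈B Wblock a) × (y ∈B Wblock a))
  W-pairCover x y x≁y with pairCover (proj₁ x) (proj₁ y) x≁y
  ... | b , (x∈b@(jx , refl) , y∈b@(jy , refl)) , unique =
    ExactlyOne-via Wblocks-↔ {Q = λ σ → (x ∈B Wblock-points σ) × (y ∈B Wblock-points σ)} σ
      (⇔.from (∈Wblock⇔ x σ) x∈b , ⇔.from (∈Wblock⇔ y σ) y∈b)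
      (λ σ′ (x∈σ′ , y∈σ′) → Fibre-≡
        (unique (proj₁ σ′) (⇔.to (∈Wblock⇔ x σ′) x∈σ′ , ⇔.to (∈Wblock⇔ y σ′) y∈σ′)))
    where
    σ : Fibre inW-block true
    σ = b , inW-block-complete (W-closed b jx jy (λ { refl → x≁y refl }) (proj₂ x) (proj₂ y))

  sub : GDD3 WPoint g v
  sub = record
    { group = proj₁ ∘ proj₁ ; groupSize = W-group-↔ ; nblocks = nWblocks
    ; block = Wblock
    ; transversal = λ a → transversal (proj₁ (from Wblocks-↔ a))
    ; pairCover = W-pairCover }

  frameGH : KirkmanFrameGH (Point g v) g (2 * g) v
  frameGH = record
    { frame = frame ; inW = isW ; sub = sub ; groupsNested = λ _ → refl
    ; blocksSub = λ a → proj₁ (from Wblocks-↔ a) , λ x →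
        mk⇔ (λ (x∈W , x∈a) → ⇔.to (∈Wblock⇔ (x , x∈W) (from Wblocks-↔ a)) x∈a)
            (λ { x∈b@(j , refl) → proj₂ (Wblock-points (from Wblocks-↔ a) j) ,
                                   ⇔.from (∈Wblock⇔ (x , _) (from Wblocks-↔ a)) x∈b }) }

-- Normalising a Kirkman frame of type (g;2g)^k

-- c classes at each of the k holes, a classes avoiding any given hole.
classes-per-hole-equation : ∀ {k a c g} → 2 ≤ k →
                            c + a ≡ k * c → 2 * g + a * 2 ≡ k * (2 * g) → c ≡ g
classes-per-hole-equation {suc k′@(suc _)} {a} {c} {g} (s≤s (s≤s z≤n)) c+a≡kc 2g+2a≡2kg =
  ℕ.*-cancelˡ-≡ c g 2 (ℕ.*-cancelˡ-≡ (2 * c) (2 * g) k′ (begin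
    k′ * (2 * c)  ≡⟨ cong (k′ *_) (ℕ.*-comm 2 c) ⟩
    k′ * (c * 2)  ≡⟨ ℕ.*-assoc k′ c 2 ⟨
    k′ * c * 2    ≡⟨ cong (_* 2) a≡k′c ⟨
    a * 2         ≡⟨ ℕ.+-cancelˡ-≡ (2 * g) _ _ 2g+2a≡2kg ⟩
    k′ * (2 * g)  ∎))
  where
  open ≡-Reasoning
  a≡k′c : a ≡ k′ * c
  a≡k′c = ℕ.+-cancelˡ-≡ c _ _ c+a≡kc

module ToCanonical {X : Set} {g k : ℕ} (F : KirkmanFrameGH X g (2 * g) k) where
  open KirkmanFrameGH F using (frame; inW; sub; groupsNested; blocksSub)
  open KirkmanFrame frame using (gdd; nclasses; cls; hole; avoidsHole; classPartition)
  open GDD3 gdd using (group; groupSize; nblocks; block; transversal; pairCover)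
  module A = GDD3 sub

  inW-fibre-↔ : ∀ i → Fibre {A = Fibre group i} (inW ∘ proj₁) true ↔ Fibre A.group i
  inW-fibre-↔ i = mk↔ₛ′
    (λ ((x , gx≡i) , x∈W) → (x , ⇔.from T-≡ x∈W) , trans (groupsNested _) gx≡i)
    (λ ((x , x∈W) , ax≡i) → (x , trans (sym (groupsNested _)) ax≡i) , ⇔.to T-≡ x∈W)
    (λ ((x , _) , _) → Fibre-≡ (cong (x ,_) (T-irrelevant _ _)))
    (λ _ → Fibre-≡ (Fibre-≡ refl))

  W-part-↔ : ∀ i → Fibre {A = Fibre group i} (inW ∘ proj₁) true ↔ Fin g
  W-part-↔ i = ↔-trans (inW-fibre-↔ i) (A.groupSize i)

  nonW-part-↔ : ∀ i → Fibre {A = Fibre group i} (inW ∘ proj₁) false ↔ Fin g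
  nonW-part-↔ i with fibre-finite _≟ᵇ_ (groupSize i) (inW ∘ proj₁) false
  ... | m , e = subst (λ m → _ ↔ Fin m) m≡g e
    where
    m≡g : m ≡ g
    m≡g = ℕ.+-cancelˡ-≡ g m g
      (trans (Bool-fibres-size (groupSize i) _ (W-part-↔ i) e) (cong (g +_) (ℕ.+-identityʳ g)))

  relabel : X ↔ Point g k
  relabel = fibres-uniform-↔ group λ i →
    fibres-uniform-↔ (inW ∘ proj₁) λ { true → W-part-↔ i ; false → nonW-part-↔ i }

  Flag : X → Set
  Flag y = Σ (Fin nblocks) λ b → Σ (Fin 3) λ p → block b p ≡ y

  position-unique : ∀ b {p q} → block b p ≡ block b q → p ≡ q
  position-unique b {p} {q} eq with p ≟ q
  ... | yes p≡q = p≡q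
  ... | no p≢q  = ⊥-elim (transversal b p q p≢q (cong group eq))

  Flag-≡ : ∀ {y} {φ ψ : Flag y} → proj₁ φ ≡ proj₁ ψ → φ ≡ ψ
  Flag-≡ {φ = b , p , e} {.b , q , e′} refl with position-unique b (trans e (sym e′))
  ... | refl = cong (λ e → b , p , e) (≡-irrelevant e e′)

  Outside : Fin k → Set
  Outside j = Fibre (λ z → ⌊ group z ≟ j ⌋) false

  other-point : ∀ {y} → Flag y × Fin 2 → X
  other-point ((b , p , _) , t) = block b (punchIn p t)

  other-point-outside : ∀ {y} (φ : Flag y × Fin 2) → group (other-point φ) ≢ group y
  other-point-outside ((b , p , refl) , t) = transversal b (punchIn p t) p (punchInᵢ≢i p t)

  flag-towards : ∀ y z → group y ≢ group z → Flag y × Fin 2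
  flag-towards y z y≁z with pairCover y z y≁z
  ... | b , ((p , e) , (q , e′)) , _ = (b , p , e) , punchOut p≢q
    where
    p≢q : p ≢ q
    p≢q refl = y≁z (cong group (trans (sym e) e′))

  other-point-flag-towards : ∀ y z y≁z → other-point (flag-towards y z y≁z) ≡ z
  other-point-flag-towards y z y≁z with pairCover y z y≁z
  ... | b , ((p , e) , (q , e′)) , _ = trans (cong (block b) (punchIn-punchOut _)) e′

  flag-towards-other-point : ∀ {y} (φ : Flag y × Fin 2) y≁z →
                             flag-towards y (other-point φ) y≁z ≡ φ
  flag-towards-other-point {y} φ@((b , p , e) , t) y≁z with pairCover y (other-point φ) y≁z
  ... | b′ , ((p′ , e₁) , (q′ , e₂)) , unique
    with unique b ((p , e) , (punchIn p t , refl))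
  ... | refl with position-unique b (trans e₁ (sym e)) | position-unique b e₂
  ... | refl | refl = cong₂ _,_ (Flag-≡ refl) (trans (punchOut-cong p refl) (punchOut-punchIn p))

  flags-↔-outside : ∀ y → (Flag y × Fin 2) ↔ Outside (group y)
  flags-↔-outside y = mk↔ₛ′
    (λ φ → other-point φ , ⇔.from (⌊⌋≡false⇔ _) (other-point-outside φ))
    (λ (z , z∉) → flag-towards y z (λ eq → ⇔.to (⌊⌋≡false⇔ _) z∉ (sym eq)))
    (λ (z , _) → Fibre-≡ (other-point-flag-towards y z _))
    (λ φ → flag-towards-other-point φ _)

  Avoiding : Fin k → Set
  Avoiding j = Fibre (λ c → ⌊ hole c ≟ j ⌋) false

  partition-of-avoiding : ∀ y ((c , _) : Avoiding (group y)) →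
                          ExactlyOne (λ b → (cls b ≡ c) × (y ∈B block b))
  partition-of-avoiding y (c , c≁y) =
    classPartition c y (λ eq → ⇔.to (⌊⌋≡false⇔ _) c≁y (sym eq))

  flag-in-class : ∀ y → Avoiding (group y) → Flag y
  flag-in-class y c with partition-of-avoiding y c
  ... | b , (_ , (p , e)) , _ = b , p , e

  class-of-flag : ∀ y → Flag y → Avoiding (group y)
  class-of-flag y (b , p , e) =
    cls b , ⇔.from (⌊⌋≡false⇔ _) (λ eq → avoidsHole b p (trans (cong group e) (sym eq)))

  flag-in-class-of-flag : ∀ y (φ : Flag y) → flag-in-class y (class-of-flag y φ) ≡ φ
  flag-in-class-of-flag y φ@(b , p , e) with partition-of-avoiding y (class-of-flag y φ)
  ... | _ , _ , unique = Flag-≡ (sym (unique b (refl , (p , e))))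

  class-of-flag-in-class : ∀ y (c : Avoiding (group y)) → class-of-flag y (flag-in-class y c) ≡ c
  class-of-flag-in-class y c with partition-of-avoiding y c
  ... | _ , (clsb≡c , _) , _ = Fibre-≡ clsb≡c

  avoiding-↔-flags : ∀ y → Avoiding (group y) ↔ Flag y
  avoiding-↔-flags y =
    mk↔ₛ′ (flag-in-class y) (class-of-flag y) (flag-in-class-of-flag y) (class-of-flag-in-class y)

  points-↔ : X ↔ Fin (k * (2 * g))
  points-↔ = ↔-trans (fibres-↔ group) (Σ-const-↔ groupSize)

  nAvoiding : Fin k → ℕ
  nAvoiding j = proj₁ (fibre-finite _≟ᵇ_ ↔-refl (λ c → ⌊ hole c ≟ j ⌋) false)

  avoiding-↔ : ∀ j → Avoiding j ↔ Fin (nAvoiding j)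
  avoiding-↔ j = proj₂ (fibre-finite _≟ᵇ_ ↔-refl (λ c → ⌊ hole c ≟ j ⌋) false)

  nWithHole : Fin k → ℕ
  nWithHole j = proj₁ (fibre-finite _≟_ ↔-refl hole j)

  withHole-↔ : ∀ j → Fibre hole j ↔ Fin (nWithHole j)
  withHole-↔ j = proj₂ (fibre-finite _≟_ ↔-refl hole j)

  avoiding-count-at : ∀ y → 2 * g + nAvoiding (group y) * 2 ≡ k * (2 * g)
  avoiding-count-at y = Bool-fibres-size points-↔ (λ z → ⌊ group z ≟ group y ⌋)
    (↔-trans (⌊≟⌋-fibre-↔ _≟_ group (group y)) (groupSize (group y)))
    (↔-trans (↔-sym (flags-↔-outside y))
             (Fin-×-↔ (↔-trans (↔-sym (avoiding-↔-flags y)) (avoiding-↔ (group y))) ↔-refl))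

  classes-count : ∀ j → nWithHole j + nAvoiding j ≡ nclasses
  classes-count j = Bool-fibres-size ↔-refl (λ c → ⌊ hole c ≟ j ⌋)
    (↔-trans (⌊≟⌋-fibre-↔ _≟_ hole j) (withHole-↔ j)) (avoiding-↔ j)

  W-closed : ∀ b (j l : Fin 3) → j ≢ l → T (inW (block b j)) → T (inW (block b l)) →
             ∀ m → T (inW (block b m))
  W-closed b j l j≢l x∈W y∈W m
    with A.pairCover (block b j , x∈W) (block b l , y∈W)
           (λ eq → transversal b j l j≢l (trans (sym (groupsNested _)) (trans eq (groupsNested _))))
  ... | a , (x∈a , y∈a) , _ with blocksSub a
  ... | b′ , a⇔b′ with pairCover (block b j) (block b l) (transversal b j l j≢l)
  ... | _ , _ , unique =
    proj₁ (⇔.from (a⇔b′ (block b m)) (subst (λ c → block b m ∈B block c) b≡b′ (m , refl)))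
    where
    b≡b′ : b ≡ b′
    b≡b′ = trans (unique b ((j , refl) , (l , refl)))
                 (sym (unique b′ (⇔.to (a⇔b′ _) (x∈W , x∈a) ,
                                  ⇔.to (a⇔b′ _) (y∈W , y∈a))))

  ∈relabel⇔ : ∀ x b → (x ∈B (to relabel ∘ block b)) ⇔ (from relabel x ∈B block b)
  ∈relabel⇔ x b = mk⇔
    (λ (j , eq) → j , trans (sym (strictlyInverseʳ relabel _)) (cong (from relabel) eq))
    (λ (j , eq) → j , inverseˡ relabel eq)

  group-from-relabel : ∀ x → group (from relabel x) ≡ proj₁ x
  group-from-relabel x = cong proj₁ (strictlyInverseˡ relabel x)

  module _ (g≥1 : 1 ≤ g) (k≥2 : 2 ≤ k) where
    open ≡-Reasoning

    avoiding-count : ∀ j → 2 * g + nAvoiding j * 2 ≡ k * (2 * g)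
    avoiding-count j with from (groupSize j) (fromℕ< (ℕ.≤-trans g≥1 (ℕ.m≤m+n g _)))
    ... | y , refl = avoiding-count-at y

    j₀ : Fin k
    j₀ = fromℕ< (ℕ.≤-trans (s≤s z≤n) k≥2)

    nAvoiding-const : ∀ j → nAvoiding j ≡ nAvoiding j₀
    nAvoiding-const j = ℕ.*-cancelʳ-≡ _ _ 2
      (ℕ.+-cancelˡ-≡ (2 * g) _ _ (trans (avoiding-count j) (sym (avoiding-count j₀))))

    nWithHole-const : ∀ j → nWithHole j ≡ nWithHole j₀
    nWithHole-const j = ℕ.+-cancelʳ-≡ _ _ _ (begin
      nWithHole j + nAvoiding j₀   ≡⟨ cong (nWithHole j +_) (nAvoiding-const j) ⟨
      nWithHole j + nAvoiding j    ≡⟨ classes-count j ⟩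
      nclasses               ≡⟨ classes-count j₀ ⟨
      nWithHole j₀ + nAvoiding j₀  ∎)

    nclasses≡k*nWithHole : nclasses ≡ k * nWithHole j₀
    nclasses≡k*nWithHole = size-unique ↔-refl (↔-trans (fibres-↔ hole)
      (Σ-const-↔ λ j → subst (λ m → Fibre hole j ↔ Fin m) (nWithHole-const j) (withHole-↔ j)))

    nWithHole≡g : ∀ j → nWithHole j ≡ g
    nWithHole≡g j = trans (nWithHole-const j)
      (classes-per-hole-equation k≥2 (trans (classes-count j₀) nclasses≡k*nWithHole)
                                     (avoiding-count j₀))

    classes-↔ : Fin nclasses ↔ (Fin k × Fin g)
    classes-↔ = fibres-uniform-↔ hole λ j →
      subst (λ m → Fibre hole j ↔ Fin m) (nWithHole≡g j) (withHole-↔ j)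

    canonical : CanonicalFrame g k
    canonical = record
      { nblocks = nblocks
      ; block = λ b → to relabel ∘ block b
      ; transversal = transversal
      ; pairCover = λ x y x≁y → ExactlyOne-map
          (λ b (x∈b , y∈b) → ⇔.from (∈relabel⇔ x b) x∈b , ⇔.from (∈relabel⇔ y b) y∈b)
          (λ b (x∈b , y∈b) → ⇔.to (∈relabel⇔ x b) x∈b , ⇔.to (∈relabel⇔ y b) y∈b)
          (pairCover (from relabel x) (from relabel y)
            (λ eq → x≁y (trans (sym (group-from-relabel x)) (trans eq (group-from-relabel y)))))
      ; W-closed = W-closed
      ; hole = hole ∘ cls
      ; class = proj₂ ∘ to classes-↔ ∘ cls
      ; avoidsHole = avoidsHole
      ; classPartition = λ i t y y≁i →
          let c = from classes-↔ (i , t) in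
          ExactlyOne-map
            (λ b (clsb≡c , y∈b) → let eq = inverseˡ classes-↔ clsb≡c in
                                  cong proj₁ eq , cong proj₂ eq , ⇔.from (∈relabel⇔ y b) y∈b)
            (λ b (hb≡i , cb≡t , y∈b) → sym (inverseʳ classes-↔ (sym (cong₂ _,_ hb≡i cb≡t))) ,
                                        ⇔.to (∈relabel⇔ y b) y∈b)
            (classPartition c (from relabel y)
              (λ eq → y≁i (trans (sym (group-from-relabel y))
                                 (trans eq (cong proj₁ (strictlyInverseˡ classes-↔ (i , t))))))) }

Fin≤1-≡ : ∀ {k} → k ≤ 1 → (i j : Fin k) → i ≡ j
Fin≤1-≡ (s≤s z≤n) zero zero = refl

trivial-canonical : ∀ {g k} → k ≤ 1 → CanonicalFrame g k
trivial-canonical k≤1 = record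
  { nblocks = 0 ; block = λ () ; transversal = λ ()
  ; pairCover = λ x y x≁y → ⊥-elim (x≁y (Fin≤1-≡ k≤1 _ _))
  ; W-closed = λ () ; hole = λ () ; class = λ () ; avoidsHole = λ ()
  ; classPartition = λ i t y y≁i → ⊥-elim (y≁i (Fin≤1-≡ k≤1 _ _)) }

canonical-frame : ∀ {g} → 1 ≤ g → ∀ k → KFExists g (2 * g) k → CanonicalFrame g k
canonical-frame g≥1 k (_ , F) with k ≤? 1
... | yes k≤1 = trivial-canonical k≤1
... | no  k≰1 = ToCanonical.canonical F g≥1 (ℕ.≰⇒> k≰1)

-- Gluing normal forms along a PBD

lookup-injective : {xs : List A} → Unique xs → ∀ i j → lookup xs i ≡ lookup xs j → i ≡ j
lookup-injective (_ ∷ _)   zero    zero    _  = refl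
lookup-injective (x∉ ∷ _)  zero    (suc j) eq = ⊥-elim (All.lookup x∉ (∈-lookup j) eq)
lookup-injective (x∉ ∷ _)  (suc i) zero    eq = ⊥-elim (All.lookup x∉ (∈-lookup i) (sym eq))
lookup-injective (_ ∷ xs!) (suc i) (suc j) eq = cong suc (lookup-injective xs! i j eq)

position : {xs : List A} {x : A} → x ∈ xs → Σ (Fin (length xs)) λ i → lookup xs i ≡ x
position x∈xs = index x∈xs , sym (lookup-index x∈xs)

module PBDClosure {g v : ℕ} {K : ℕ → Set} (P : PBD v K)
                  (frames : ∀ B → CanonicalFrame g (length (PBD.block P B))) where
  open PBD P using (blockDistinct)
    renaming (nblocks to nPBDblocks; block to pbdBlock; pairCover to pbd-pairCover)
  module C B = CanonicalFrame (frames B)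

  embed : ∀ B → Point g (length (pbdBlock B)) → Point g v
  embed B (i , x) = lookup (pbdBlock B) i , x

  embed-injective : ∀ B {p q} → embed B p ≡ embed B q → p ≡ q
  embed-injective B {i , _} {j , _} eq
    with lookup-injective (blockDistinct B) i j (cong proj₁ eq) | cong proj₂ eq
  ... | refl | refl = refl

  Blocks : Set
  Blocks = Σ (Fin nPBDblocks) (Fin ∘ C.nblocks)

  blocks-↔ : Blocks ↔ Fin (foldr _+_ 0 C.nblocks)
  blocks-↔ = Σ-Fin-↔ C.nblocks

  blockΣ : Blocks → Fin 3 → Point g v
  blockΣ (B , b) = embed B ∘ C.block B b

  holeΣ : Blocks → Fin v
  holeΣ (B , b) = lookup (pbdBlock B) (C.hole B b)

  classΣ : Blocks → Fin g
  classΣ (B , b) = C.class B b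

  ∈embed⇔ : ∀ B {p f} → (embed B p ∈B (embed B ∘ f)) ⇔ (p ∈B f)
  ∈embed⇔ B = mk⇔ (λ (j , eq) → j , embed-injective B eq) (λ (j , eq) → j , cong (embed B) eq)

  ∈blockΣ⇒∈pbdBlock : ∀ σ {x} → x ∈B blockΣ σ → proj₁ x ∈ pbdBlock (proj₁ σ)
  ∈blockΣ⇒∈pbdBlock (B , b) (j , refl) = ∈-lookup _

  localise : ∀ B (x : Point g v) → proj₁ x ∈ pbdBlock B →
             Σ (Point g (length (pbdBlock B))) λ p → embed B p ≡ x
  localise B (_ , x) i∈B with position i∈B
  ... | i , eq = (i , x) , cong (_, x) eq

  pairCoverΣ : ∀ (x y : Point g v) → proj₁ x ≢ proj₁ y →
               ExactlyOne (λ β → let σ = from blocks-↔ β in (x ∈B blockΣ σ) × (y ∈B blockΣ σ))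
  pairCoverΣ x y x≁y with pbd-pairCover (proj₁ x) (proj₁ y) x≁y
  ... | B , (x∈B , y∈B) , uniqueB with localise B x x∈B | localise B y y∈B
  ... | p , refl | q , refl =
    ExactlyOne-Σ blocks-↔ {Q = λ σ → (embed B p ∈B blockΣ σ) × (embed B q ∈B blockΣ σ)} B
      (λ σ (p∈σ , q∈σ) →
        uniqueB (proj₁ σ) (∈blockΣ⇒∈pbdBlock σ p∈σ , ∈blockΣ⇒∈pbdBlock σ q∈σ))
      (ExactlyOne-map (λ _ (p∈b , q∈b) → ⇔.from (∈embed⇔ B) p∈b , ⇔.from (∈embed⇔ B) q∈b)
                      (λ _ (p∈b , q∈b) → ⇔.to (∈embed⇔ B) p∈b , ⇔.to (∈embed⇔ B) q∈b)
                      (C.pairCover B p q (x≁y ∘ cong (lookup (pbdBlock B)))))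

  classPartitionΣ : ∀ (i : Fin v) (t : Fin g) (y : Point g v) → proj₁ y ≢ i →
                    ExactlyOne (λ β → let σ = from blocks-↔ β in
                                      (holeΣ σ ≡ i) × (classΣ σ ≡ t) × (y ∈B blockΣ σ))
  classPartitionΣ i t y y≁i with pbd-pairCover i (proj₁ y) (y≁i ∘ sym)
  ... | B , (i∈B , y∈B) , uniqueB with position i∈B | localise B y y∈B
  ... | iB , refl | q , refl =
    ExactlyOne-Σ blocks-↔
      {Q = λ σ → (holeΣ σ ≡ i) × (classΣ σ ≡ t) × (embed B q ∈B blockΣ σ)} B
      (λ σ (hσ≡i , _ , q∈σ) → uniqueB (proj₁ σ)
        (subst (_∈ pbdBlock (proj₁ σ)) hσ≡i (∈-lookup _) , ∈blockΣ⇒∈pbdBlock σ q∈σ))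
      (ExactlyOne-map
        (λ _ (hb≡iB , cb≡t , q∈b) →
          cong (lookup (pbdBlock B)) hb≡iB , cb≡t , ⇔.from (∈embed⇔ B) q∈b)
        (λ _ (hb≡i , cb≡t , q∈b) →
          lookup-injective (blockDistinct B) _ _ hb≡i , cb≡t , ⇔.to (∈embed⇔ B) q∈b)
        (C.classPartition B iB t q (y≁i ∘ cong (lookup (pbdBlock B)))))

  canonical : CanonicalFrame g v
  canonical = record
    { nblocks = foldr _+_ 0 C.nblocks
    ; block = blockΣ ∘ from blocks-↔
    ; transversal = λ β j l j≢l → let (B , b) = from blocks-↔ β in
        C.transversal B b j l j≢l ∘ lookup-injective (blockDistinct B) _ _
    ; pairCover = pairCoverΣ
    ; W-closed = λ β → let (B , b) = from blocks-↔ β in C.W-closed B b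
    ; hole = holeΣ ∘ from blocks-↔
    ; class = classΣ ∘ from blocks-↔
    ; avoidsHole = λ β j → let (B , b) = from blocks-↔ β in
        C.avoidsHole B b j ∘ lookup-injective (blockDistinct B) _ _
    ; classPartition = classPartitionΣ }

-- PBD blocks of size at most 1 carry the empty frame.
theorem3p3 : (g : ℕ) → 1 ≤ g → (K : ℕ → Set) → (∀ k → K k → 1 ≤ k) →
    (v : ℕ) → PBD v K → (∀ k → K k → KFExists g (2 * g) k) →
    KFExists g (2 * g) v
theorem3p3 g g≥1 K _ v P frames =
  Point g v , FromCanonical.frameGH
    (PBDClosure.canonical P λ B → canonical-frame g≥1 _ (frames _ (PBD.blockSize P B)))
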